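{- Let $(V,\mathcal{E})$ be a finite $3$-uniform hypergraph with at least two vertices in which no four vertices induce exactly four hyperedges. Then $(V,\mathcal{E})$ has the De Bruijn–Erdős property: either it has at least $|V|$ distinct lines, or one of its lines equals $V$.
   Context: A $3$-uniform hypergraph $(V,\mathcal{E})$ has all hyperedges of size three. For distinct vertices $u,v$, the line $\overline{uv}$ is the set consisting of $u$, $v$, and all $w$ with $\{u,v,w\}\in\mathcal{E}$. Four distinct vertices induce four hyperedges if all four of their three-element subsets belong to $\mathcal{E}$. -}

module Defs where

open import Data.Nat using (ℕ; _≤_)
open import Data.Bool using (Bool; true; false; _∨_)
open import Data.Fin using (Fin; _≟_)
open import Data.Fin.Subset using (Subset; ⊤)
open import Data.Vec using (tabulate)
open import Data.Product using (Σ; ∃; _×_; _,_; proj₁; proj₂)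
open import Relation.Nullary using (¬_)
open import Relation.Nullary.Decidable using (⌊_⌋)
open import Relation.Binary.PropositionalEquality using (_≡_; _≢_)

-- The hyperedge set is given
-- by its characteristic function on triples; it must be invariant under
-- permutations of the triple (hyperedges are 3-element sets) and only
-- contain triples of pairwise distinct vertices.
record Hypergraph3 (n : ℕ) : Set where
  field
    E      : Fin n → Fin n → Fin n → Bool
    sym₁₂  : ∀ a b c → E a b c ≡ E b a c
    sym₂₃  : ∀ a b c → E a b c ≡ E a c b
    distinct : ∀ a b c → E a b c ≡ true → (a ≢ b) × (b ≢ c) × (a ≢ c)
open Hypergraph3 public

line : ∀ {n} → Hypergraph3 n → Fin n → Fin n → Subset n
line H u v = tabulate (λ w → ⌊ w ≟ u ⌋ ∨ ⌊ w ≟ v ⌋ ∨ E H u v w)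

Induces4 : ∀ {n} → Hypergraph3 n → Fin n → Fin n → Fin n → Fin n → Set
Induces4 H a b c d =
  (a ≢ b) × (a ≢ c) × (a ≢ d) × (b ≢ c) × (b ≢ d) × (c ≢ d) ×
  (E H a b c ≡ true) × (E H a b d ≡ true) × (E H a c d ≡ true) × (E H b c d ≡ true)

No4Induced : ∀ {n} → Hypergraph3 n → Set
No4Induced H = ∀ a b c d → ¬ Induces4 H a b c d

AtLeastNLines : ∀ {n} → Hypergraph3 n → Set
AtLeastNLines {n} H =
  Σ (Fin n → Fin n × Fin n) λ f →
    (∀ i → proj₁ (f i) ≢ proj₂ (f i)) ×
    (∀ i j → line H (proj₁ (f i)) (proj₂ (f i)) ≡ line H (proj₁ (f j)) (proj₂ (f j)) → i ≡ j)

HasUniversalLine : ∀ {n} → Hypergraph3 n → Set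
HasUniversalLine {n} H = ∃ λ u → ∃ λ v → (u ≢ v) × (line H u v ≡ ⊤)

-- Fix the vertex 0 (the apex) and group the other vertices j by their star, the line through 0 and j,
-- with a representative r in each class. Each j contributes a spoke: the line 0j if j = r, else the
-- line rj. Spokes pass through 0, and the absence of four vertices inducing four hyperedges makes them
-- pairwise distinct, except that a spoke rj may coincide with 0j; that line is then exactly the
-- triangle {0, r, j}, and j is dropped. With k such triangles there are n - 1 - k spokes, and the
-- k + 1 missing lines avoid 0: a line through a non-edge at 0 when k = 0, the two lines from a vertex
-- off the triangle when k = 1, and the four lines joining the vertices of two triangles, for disjoint
-- pairs of triangles, when k ≥ 2. When these lines do not exist, a line through 0 covers every vertex.

module Submission where

open import Defs
open import Data.Bool using (true; false; _∨_)
open import Data.Bool.Properties using (∨-zeroʳ; ¬-not) renaming (_≟_ to _≟ᵇ_)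
open import Data.Empty using (⊥; ⊥-elim)
open import Data.Fin using (Fin; zero; suc; _≟_; inject≤)
open import Data.Fin.Properties using (suc-injective; any?; inject≤-injective)
open import Data.Fin.Subset using (Subset; ⊤)
open import Data.List as List using (List; []; _∷_; length; map; filter; _++_; allFin)
open import Data.List.Properties using (length-++; length-map; length-tabulate)
open import Data.List.Membership.Propositional.Properties using (∈-lookup)
open import Data.List.Relation.Unary.All as All using (All; []; _∷_)
import Data.List.Relation.Unary.All.Properties as All
open import Data.List.Relation.Unary.AllPairs using (AllPairs; []; _∷_)
import Data.List.Relation.Unary.AllPairs.Properties as AllPairs
import Data.List.Relation.Unary.Unique.Propositional.Properties as Unique
open import Data.Nat using (ℕ; zero; suc; _≤_; _+_; z≤n; s≤s)
open import Data.Nat.Properties using (≤-refl; ≤-trans; +-suc; +-monoˡ-≤; m≤n+m; module ≤-Reasoning)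
open import Data.Product using (∃; Σ-syntax; _×_; _,_; proj₁; proj₂)
open import Data.Sum using (_⊎_; inj₁; inj₂; [_,_])
open import Data.Vec using ([]; _∷_; tabulate; lookup)
open import Data.Vec.Properties using (lookup∘tabulate; ≡-dec)
open import Function using (_∘_)
open import Relation.Binary.Definitions using (DecidableEquality)
open import Relation.Binary.PropositionalEquality
  using (_≡_; _≢_; refl; sym; trans; cong; cong₂; subst; ≢-sym; module ≡-Reasoning)
open import Relation.Nullary using (¬_; Dec; yes; no; contradiction)
open import Relation.Nullary.Decidable using (⌊_⌋; isYes≗does; dec-true; dec-false; ¬?; _×-dec_; _⊎-dec_)
open import Relation.Unary using (Decidable)
open import Relation.Unary.Properties using (∁?)

module _ {A : Set} (_≟ᴬ_ : DecidableEquality A) {m : ℕ} (f : Fin (suc m) → A) where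

  private
    choose : ∀ {y} → Dec (∃ λ i → f i ≡ y) → Fin (suc m)
    choose (yes (i , _)) = i
    choose (no _)        = zero

    choose-correct : ∀ {y} (d : Dec (∃ λ i → f i ≡ y)) → ∃ (λ i → f i ≡ y) → f (choose d) ≡ y
    choose-correct (yes (_ , fi≡y)) _     = fi≡y
    choose-correct (no ∄)           fj≡y = contradiction fj≡y ∄

  preimage : A → Fin (suc m)
  preimage y = choose (any? (λ i → f i ≟ᴬ y))

  f∘preimage : ∀ j → f (preimage (f j)) ≡ f j
  f∘preimage j = choose-correct (any? (λ i → f i ≟ᴬ f j)) (j , refl)

module _ {A : Set} {P : A → Set} (P? : Decidable P) where

  length-filter+filter-∁ : ∀ xs → length (filter P? xs) + length (filter (∁? P?) xs) ≡ length xs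
  length-filter+filter-∁ []       = refl
  length-filter+filter-∁ (x ∷ xs) with P? x
  ... | yes _ = cong suc (length-filter+filter-∁ xs)
  ... | no  _ = trans (+-suc _ _) (cong suc (length-filter+filter-∁ xs))

module _ {A : Set} {R : A → A → Set} where

  AllPairs-lookup : ∀ {xs} → AllPairs R xs → ∀ {i j} → i ≢ j →
                    R (List.lookup xs i) (List.lookup xs j) ⊎ R (List.lookup xs j) (List.lookup xs i)
  AllPairs-lookup (_ ∷ _)     {zero}  {zero}  i≢j = contradiction refl i≢j
  AllPairs-lookup (Rx ∷ _)    {zero}  {suc j} _   = inj₁ (All.lookup Rx (∈-lookup j))
  AllPairs-lookup (Rx ∷ _)    {suc i} {zero}  _   = inj₂ (All.lookup Rx (∈-lookup i))
  AllPairs-lookup (_ ∷ Rxs)   {suc i} {suc j} i≢j = AllPairs-lookup Rxs (i≢j ∘ cong suc)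

  AllPairs-mapWithAll : ∀ {P : A → Set} {S : A → A → Set} → (∀ {x y} → P x → P y → R x y → S x y) →
                        ∀ {xs} → All P xs → AllPairs R xs → AllPairs S xs
  AllPairs-mapWithAll f []         []         = []
  AllPairs-mapWithAll f (px ∷ pxs) (Rx ∷ Rxs) =
    All.zipWith (λ (py , Rxy) → f px py Rxy) (pxs , Rx) ∷ AllPairs-mapWithAll f pxs Rxs

⌊⌋-true : ∀ {P : Set} (P? : Dec P) → P → ⌊ P? ⌋ ≡ true
⌊⌋-true P? p = trans (isYes≗does P?) (dec-true P? p)

⌊⌋-false : ∀ {P : Set} (P? : Dec P) → ¬ P → ⌊ P? ⌋ ≡ false
⌊⌋-false P? ¬p = trans (isYes≗does P?) (dec-false P? ¬p)

all-inside⇒⊤ : ∀ {k} (s : Subset k) → (∀ x → lookup s x ≡ true) → s ≡ ⊤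
all-inside⇒⊤ []      _      = refl
all-inside⇒⊤ (b ∷ s) inside =
  trans (cong (_∷ s) (inside zero)) (cong (true ∷_) (all-inside⇒⊤ s (inside ∘ suc)))

module Lines {k : ℕ} (H : Hypergraph3 k) where

  private variable
    a b c d x y : Fin k

  E-rotate : ∀ a b c → E H a b c ≡ E H b c a
  E-rotate a b c = trans (sym₁₂ H a b c) (sym₂₃ H b a c)

  lookup-line : ∀ u v w → lookup (line H u v) w ≡ (⌊ w ≟ u ⌋ ∨ ⌊ w ≟ v ⌋ ∨ E H u v w)
  lookup-line u v w = lookup∘tabulate _ w

  ∈-lineˡ : ∀ u v → lookup (line H u v) u ≡ true
  ∈-lineˡ u v = trans (lookup-line u v u) (cong (_∨ (⌊ u ≟ v ⌋ ∨ E H u v u)) (⌊⌋-true (u ≟ u) refl))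

  ∈-lineʳ : ∀ u v → lookup (line H u v) v ≡ true
  ∈-lineʳ u v = begin
    lookup (line H u v) v              ≡⟨ lookup-line u v v ⟩
    ⌊ v ≟ u ⌋ ∨ ⌊ v ≟ v ⌋ ∨ E H u v v  ≡⟨ cong (λ b → ⌊ v ≟ u ⌋ ∨ b ∨ E H u v v) (⌊⌋-true (v ≟ v) refl) ⟩
    ⌊ v ≟ u ⌋ ∨ true                   ≡⟨ ∨-zeroʳ _ ⟩
    true                               ∎
    where open ≡-Reasoning

  lookup-line-off : x ≢ a → x ≢ b → lookup (line H a b) x ≡ E H a b x
  lookup-line-off {x} {a} {b} x≢a x≢b
    rewrite lookup-line a b x | ⌊⌋-false (x ≟ a) x≢a | ⌊⌋-false (x ≟ b) x≢b = refl

  line≡⇒edge : line H a b ≡ line H c d → x ≢ a → x ≢ b → lookup (line H c d) x ≡ true → E H a b x ≡ true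
  line≡⇒edge {x = x} ab≡cd x≢a x≢b x∈cd =
    trans (sym (lookup-line-off x≢a x≢b)) (trans (cong (λ s → lookup s x) ab≡cd) x∈cd)

  line≡⇒edge≡ : line H a b ≡ line H c d → x ≢ a → x ≢ b → x ≢ c → x ≢ d → E H a b x ≡ E H c d x
  line≡⇒edge≡ {x = x} ab≡cd x≢a x≢b x≢c x≢d =
    trans (sym (lookup-line-off x≢a x≢b)) (trans (cong (λ s → lookup s x) ab≡cd) (lookup-line-off x≢c x≢d))

  separated⇒≢ : ∀ {s t : Subset k} x → lookup s x ≡ true → lookup t x ≡ false → s ≢ t
  separated⇒≢ x x∈s x∉t s≡t with trans (sym x∈s) (trans (cong (λ r → lookup r x) s≡t) x∉t)
  ... | ()

  line-universal : ∀ a b → (∀ w → lookup (line H a b) w ≡ true) → line H a b ≡ ⊤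
  line-universal a b = all-inside⇒⊤ (line H a b)

  lineOf : Fin k × Fin k → Subset k
  lineOf (a , b) = line H a b

  Proper : Fin k × Fin k → Set
  Proper (a , b) = a ≢ b

  _∈ᵥ_ : Fin k → Fin k × Fin k → Set
  x ∈ᵥ (a , b) = x ≡ a ⊎ x ≡ b

  _∈ᵥ?_ : ∀ x p → Dec (x ∈ᵥ p)
  x ∈ᵥ? (a , b) = (x ≟ a) ⊎-dec (x ≟ b)

  Disjoint : Fin k × Fin k → Fin k × Fin k → Set
  Disjoint p q = ∀ x → x ∈ᵥ p → x ∈ᵥ q → ⊥

  Disjoint-sym : ∀ {p q} → Disjoint p q → Disjoint q p
  Disjoint-sym p∩q x x∈q x∈p = p∩q x x∈p x∈q

  DistinctLines : List (Fin k × Fin k) → Set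
  DistinctLines ps = All Proper ps × AllPairs (λ p q → lineOf p ≢ lineOf q) ps

  DistinctLines-++⁺ : ∀ {ps qs} → DistinctLines ps → DistinctLines qs →
                      All (λ p → All (λ q → lineOf p ≢ lineOf q) qs) ps → DistinctLines (ps ++ qs)
  DistinctLines-++⁺ (ps-proper , ps-distinct) (qs-proper , qs-distinct) ps≢qs =
    All.++⁺ ps-proper qs-proper , AllPairs.++⁺ ps-distinct qs-distinct ps≢qs

  DistinctLines-separated : ∀ {ps qs} z → All (λ p → lookup (lineOf p) z ≡ false) ps →
                            All (λ q → lookup (lineOf q) z ≡ true) qs →
                            DistinctLines ps → DistinctLines qs → DistinctLines (ps ++ qs)
  DistinctLines-separated {qs = qs} z z∉ps z∈qs ps-lines qs-lines =
    DistinctLines-++⁺ ps-lines qs-lines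
      (All.map (λ z∉p → All.map (λ z∈q → ≢-sym (separated⇒≢ z z∈q z∉p)) z∈qs) z∉ps)

  DistinctLines⇒AtLeastNLines : ∀ {ps} → DistinctLines ps → k ≤ length ps → AtLeastNLines H
  DistinctLines⇒AtLeastNLines {ps} (proper , distinct) k≤ =
    pick , (λ i → All.lookup proper (∈-lookup (inject≤ i k≤))) , injective
    where
    pick : Fin k → Fin k × Fin k
    pick i = List.lookup ps (inject≤ i k≤)

    injective : ∀ i j → lineOf (pick i) ≡ lineOf (pick j) → i ≡ j
    injective i j eq with i ≟ j
    ... | yes i≡j = i≡j
    ... | no  i≢j = ⊥-elim ([ (λ ≢ → ≢ eq) , (λ ≢ → ≢ (sym eq)) ]
                             (AllPairs-lookup distinct (i≢j ∘ inject≤-injective k≤ k≤ i j)))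

  Triangle : Fin k → Fin k → Fin k → Set
  Triangle a b c = a ≢ b × b ≢ c × a ≢ c × line H a b ≡ line H a c × line H b c ≡ line H a c

  module _ (no4 : No4Induced H) where

    disjoint-lines-distinct : ∀ {p q} → Proper p → Proper q → Disjoint p q → lineOf p ≢ lineOf q
    disjoint-lines-distinct {a , b} {c , d} a≢b c≢d p∩q ab≡cd =
      no4 a b c d (a≢b , a≢c , a≢d , b≢c , b≢d , c≢d , abc , abd ,
                   trans (E-rotate a c d) cda , trans (E-rotate b c d) cdb)
      where
      a≢c : a ≢ c
      a≢c e = p∩q _ (inj₁ refl) (inj₁ e)
      a≢d : a ≢ d
      a≢d e = p∩q _ (inj₁ refl) (inj₂ e)
      b≢c : b ≢ c
      b≢c e = p∩q _ (inj₂ refl) (inj₁ e)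
      b≢d : b ≢ d
      b≢d e = p∩q _ (inj₂ refl) (inj₂ e)
      abc = line≡⇒edge ab≡cd (≢-sym a≢c) (≢-sym b≢c) (∈-lineˡ c d)
      abd = line≡⇒edge ab≡cd (≢-sym a≢d) (≢-sym b≢d) (∈-lineʳ c d)
      cda = line≡⇒edge (sym ab≡cd) a≢c a≢d (∈-lineˡ a b)
      cdb = line≡⇒edge (sym ab≡cd) b≢c b≢d (∈-lineʳ a b)

    -- A triangle is a whole line: a fourth vertex on it would induce four hyperedges.
    triangle-closed : Triangle a b c → y ≢ a → y ≢ b → y ≢ c →
                      E H a b y ≡ false × E H a c y ≡ false × E H b c y ≡ false
    triangle-closed {a} {b} {c} {y} (a≢b , b≢c , a≢c , ab≡ac , bc≡ac) y≢a y≢b y≢c =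
      trans ab~ac ac-y , ac-y , trans bc~ac ac-y
      where
      ab~ac : E H a b y ≡ E H a c y
      ab~ac = line≡⇒edge≡ ab≡ac y≢a y≢b y≢a y≢c
      bc~ac : E H b c y ≡ E H a c y
      bc~ac = line≡⇒edge≡ bc≡ac y≢b y≢c y≢a y≢c
      ac-y : E H a c y ≡ false
      ac-y = ¬-not λ acy →
        no4 a b c y (a≢b , a≢c , ≢-sym y≢a , b≢c , ≢-sym y≢b , ≢-sym y≢c ,
                     line≡⇒edge ab≡ac (≢-sym a≢c) (≢-sym b≢c) (∈-lineʳ a c) ,
                     trans ab~ac acy , acy , trans bc~ac acy)

-- Lines avoiding the apex

module Apex {m : ℕ} (H : Hypergraph3 (suc (suc m))) (no4 : No4Induced H) where

  open Lines H

  V : Set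
  V = Fin (suc (suc m))

  private variable
    i j : Fin (suc m)
    t u : V × V
    x y : V

  Avoids : V × V → Set
  Avoids p = lookup (lineOf p) zero ≡ false

  Through : V × V → Set
  Through p = lookup (lineOf p) zero ≡ true

  LinesAvoidingApex : ℕ → Set
  LinesAvoidingApex n = Σ[ ps ∈ List (V × V) ] DistinctLines ps × All Avoids ps × suc n ≤ length ps

  -- (w , v) stands for the triangle {0, w, v}.
  ApexTriangle : V × V → Set
  ApexTriangle (w , v) = Triangle zero w v

  Off : V × V → V → Set
  Off t y = y ≢ zero × ¬ y ∈ᵥ t

  apex∉ : ApexTriangle t → x ∈ᵥ t → x ≢ zero
  apex∉ (0≢w , _)           (inj₁ refl) = ≢-sym 0≢w
  apex∉ (_ , _ , 0≢v , _) (inj₂ refl) = ≢-sym 0≢v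

  apex-triangle-closed : ∀ {w v y} → ApexTriangle (w , v) → Off (w , v) y →
                         E H zero w y ≡ false × E H zero v y ≡ false × E H w v y ≡ false
  apex-triangle-closed ▵ (y≢0 , y∉t) = triangle-closed no4 ▵ y≢0 (y∉t ∘ inj₁) (y∉t ∘ inj₂)

  apex-edge-free : ApexTriangle t → x ∈ᵥ t → Off t y → E H zero x y ≡ false
  apex-edge-free ▵ (inj₁ refl) off = proj₁ (apex-triangle-closed ▵ off)
  apex-edge-free ▵ (inj₂ refl) off = proj₁ (proj₂ (apex-triangle-closed ▵ off))

  side-edge-free : ∀ {x z} → ApexTriangle t → x ∈ᵥ t → z ∈ᵥ t → x ≢ z → Off t y → E H x z y ≡ false
  side-edge-free ▵ (inj₁ refl) (inj₁ refl) x≢z _   = contradiction refl x≢z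
  side-edge-free ▵ (inj₁ refl) (inj₂ refl) _   off = proj₂ (proj₂ (apex-triangle-closed ▵ off))
  side-edge-free ▵ (inj₂ refl) (inj₁ refl) _   off = trans (sym₁₂ H _ _ _) (proj₂ (proj₂ (apex-triangle-closed ▵ off)))
  side-edge-free ▵ (inj₂ refl) (inj₂ refl) x≢z _   = contradiction refl x≢z

  off-line-avoids : ApexTriangle t → x ∈ᵥ t → Off t y → Avoids (x , y)
  off-line-avoids {x = x} {y} ▵ x∈t off =
    trans (lookup-line-off (≢-sym (apex∉ ▵ x∈t)) (≢-sym (proj₁ off)))
          (trans (sym (E-rotate zero x y)) (apex-edge-free ▵ x∈t off))

  lines-to-side-distinct : ∀ {y z} → ApexTriangle t → y ∈ᵥ t → z ∈ᵥ t → y ≢ z → Off t x →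
                           line H x y ≢ line H x z
  lines-to-side-distinct {x = x} {y} {z} ▵ y∈t z∈t y≢z off =
    ≢-sym (separated⇒≢ z (∈-lineʳ x z) z∉xy)
    where
    z∉xy : lookup (line H x y) z ≡ false
    z∉xy = trans (lookup-line-off (λ z≡x → proj₂ off (subst (_∈ᵥ _) z≡x z∈t)) (≢-sym y≢z))
                 (trans (E-rotate x y z) (side-edge-free ▵ y∈t z∈t y≢z off))

  lines-from-side-distinct : ∀ {z} → ApexTriangle t → x ∈ᵥ t → z ∈ᵥ t → x ≢ z → Off t y →
                             line H x y ≢ line H z y
  lines-from-side-distinct {x = x} {y} {z} ▵ x∈t z∈t x≢z off =
    ≢-sym (separated⇒≢ z (∈-lineˡ z y) z∉xy)
    where
    z∉xy : lookup (line H x y) z ≡ false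
    z∉xy = trans (lookup-line-off (≢-sym x≢z) (λ z≡y → proj₂ off (subst (_∈ᵥ _) z≡y z∈t)))
                 (trans (sym₂₃ H x y z) (side-edge-free ▵ x∈t z∈t x≢z off))

  Across : V × V → V × V → V × V → Set
  Across t u p = proj₁ p ∈ᵥ t × proj₂ p ∈ᵥ u

  cross : V × V → V × V → List (V × V)
  cross (w , v) (w′ , v′) = (w , w′) ∷ (w , v′) ∷ (v , w′) ∷ (v , v′) ∷ []

  cross-across : ∀ t u → All (Across t u) (cross t u)
  cross-across t u = (inj₁ refl , inj₁ refl) ∷ (inj₁ refl , inj₂ refl) ∷
                     (inj₂ refl , inj₁ refl) ∷ (inj₂ refl , inj₂ refl) ∷ []

  across-off : ApexTriangle u → Disjoint t u → x ∈ᵥ u → Off t x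
  across-off ▵u t∩u x∈u = apex∉ ▵u x∈u , λ x∈t → t∩u _ x∈t x∈u

  across-proper : ∀ {p} → Disjoint t u → Across t u p → Proper p
  across-proper t∩u (x∈t , y∈u) x≡y = t∩u _ x∈t (subst (_∈ᵥ _) (sym x≡y) y∈u)

  across-avoids : ∀ {p} → ApexTriangle t → ApexTriangle u → Disjoint t u → Across t u p → Avoids p
  across-avoids ▵t ▵u t∩u (x∈t , y∈u) = off-line-avoids ▵t x∈t (across-off ▵u t∩u y∈u)

  across-disjoint : ∀ {p s} → Across t u p → Disjoint t s → Disjoint u s → Disjoint p s
  across-disjoint (x∈t , _) t∩s _ _ (inj₁ refl) = t∩s _ x∈t
  across-disjoint (_ , y∈u) _ u∩s _ (inj₂ refl) = u∩s _ y∈u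

  parallel-disjoint : ∀ {p q} → Disjoint t u → Across t u p → Across t u q →
                      proj₁ p ≢ proj₁ q → proj₂ p ≢ proj₂ q → Disjoint p q
  parallel-disjoint _   _         _          x≢x′ _    _ (inj₁ refl) (inj₁ e) = x≢x′ e
  parallel-disjoint t∩u (x∈t , _) (_ , y′∈u) _    _    _ (inj₁ refl) (inj₂ e) = t∩u _ x∈t (subst (_∈ᵥ _) (sym e) y′∈u)
  parallel-disjoint t∩u (_ , y∈u) (x′∈t , _) _    _    _ (inj₂ refl) (inj₁ e) = t∩u _ (subst (_∈ᵥ _) (sym e) x′∈t) y∈u
  parallel-disjoint _   _         _          _    y≢y′ _ (inj₂ refl) (inj₂ e) = y≢y′ e

  cross-lines : ApexTriangle t → ApexTriangle u → Disjoint t u → DistinctLines (cross t u)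
  cross-lines {w , v} {w′ , v′} ▵t@(_ , w≢v , _) ▵u@(_ , w′≢v′ , _) t∩u =
    All.map (across-proper t∩u) (cross-across _ _) ,
    (to-side (inj₁ refl) ∷ from-side (inj₁ refl) ∷ parallel (inj₁ refl , inj₁ refl) (inj₂ refl , inj₂ refl) w≢v w′≢v′ ∷ []) ∷
    (parallel (inj₁ refl , inj₂ refl) (inj₂ refl , inj₁ refl) w≢v (≢-sym w′≢v′) ∷ from-side (inj₂ refl) ∷ []) ∷
    (to-side (inj₂ refl) ∷ []) ∷
    [] ∷ []
    where
    to-side : ∀ {x} → x ∈ᵥ (w , v) → line H x w′ ≢ line H x v′
    to-side x∈t = lines-to-side-distinct ▵u (inj₁ refl) (inj₂ refl) w′≢v′ (across-off ▵t (Disjoint-sym t∩u) x∈t)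

    from-side : ∀ {y} → y ∈ᵥ (w′ , v′) → line H w y ≢ line H v y
    from-side y∈u = lines-from-side-distinct ▵t (inj₁ refl) (inj₂ refl) w≢v (across-off ▵u t∩u y∈u)

    parallel : ∀ {p q} → Across (w , v) (w′ , v′) p → Across (w , v) (w′ , v′) q →
               proj₁ p ≢ proj₁ q → proj₂ p ≢ proj₂ q → lineOf p ≢ lineOf q
    parallel p∈ q∈ x≢x′ y≢y′ =
      disjoint-lines-distinct no4 (across-proper t∩u p∈) (across-proper t∩u q∈)
        (parallel-disjoint t∩u p∈ q∈ x≢x′ y≢y′)

  -- Four lines for each pair of consecutive triangles: 4 ⌊k/2⌋ ≥ k + 1 once k ≥ 2.
  blocks : List (V × V) → List (V × V)
  blocks (t ∷ u ∷ ts) = cross t u ++ blocks ts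
  blocks _            = []

  blocks-length : ∀ ts → length ts ≤ suc (length (blocks ts))
  blocks-length []           = z≤n
  blocks-length (_ ∷ [])     = s≤s z≤n
  blocks-length (_ ∷ _ ∷ ts) = s≤s (s≤s (≤-trans (blocks-length ts) (m≤n+m _ 2)))

  blocks-disjoint : ∀ {s} ts → All (λ t → Disjoint t s) ts → All (λ p → Disjoint p s) (blocks ts)
  blocks-disjoint []           _                  = []
  blocks-disjoint (_ ∷ [])     _                  = []
  blocks-disjoint (t ∷ u ∷ ts) (t∩s ∷ u∩s ∷ ts∩s) =
    All.++⁺ (All.map (λ p∈ → across-disjoint p∈ t∩s u∩s) (cross-across t u)) (blocks-disjoint ts ts∩s)

  blocks-avoid : ∀ ts → All ApexTriangle ts → AllPairs Disjoint ts → All Avoids (blocks ts)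
  blocks-avoid []           _                 _                       = []
  blocks-avoid (_ ∷ [])     _                 _                       = []
  blocks-avoid (t ∷ u ∷ ts) (▵t ∷ ▵u ∷ ▵s) ((t∩u ∷ _) ∷ _ ∷ disjoint) =
    All.++⁺ (All.map (across-avoids ▵t ▵u t∩u) (cross-across t u)) (blocks-avoid ts ▵s disjoint)

  blocks-lines : ∀ ts → All ApexTriangle ts → AllPairs Disjoint ts → DistinctLines (blocks ts)
  blocks-lines []           _                 _                                = [] , []
  blocks-lines (_ ∷ [])     _                 _                                = [] , []
  blocks-lines (t ∷ u ∷ ts) (▵t ∷ ▵u ∷ ▵s) ((t∩u ∷ t∩ts) ∷ u∩ts ∷ disjoint) =
    DistinctLines-++⁺ (cross-lines ▵t ▵u t∩u) rest (All.map apart (cross-across t u))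
    where
    rest : DistinctLines (blocks ts)
    rest = blocks-lines ts ▵s disjoint

    apart : ∀ {p} → Across t u p → All (λ q → lineOf p ≢ lineOf q) (blocks ts)
    apart p∈ =
      All.zipWith (λ (q-proper , q∩p) → disjoint-lines-distinct no4 (across-proper t∩u p∈) q-proper (Disjoint-sym q∩p))
        (proj₁ rest , blocks-disjoint ts
          (All.zipWith (λ (t∩s , u∩s) → Disjoint-sym (across-disjoint p∈ t∩s u∩s)) (t∩ts , u∩ts)))

  no-triangle : HasUniversalLine H ⊎ LinesAvoidingApex 0
  no-triangle with any? (λ a → any? (λ b → ¬? (a ≟ b) ×-dec (E H zero (suc a) (suc b) ≟ᵇ false)))
  ... | yes (a , b , a≢b , non-edge) =
    inj₂ ((suc a , suc b) ∷ [] , ((a≢b ∘ suc-injective) ∷ [] , [] ∷ []) , avoids ∷ [] , ≤-refl)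
    where
    avoids : Avoids (suc a , suc b)
    avoids = trans (lookup-line-off (λ ()) (λ ())) (trans (sym (E-rotate zero (suc a) (suc b))) non-edge)
  ... | no ∄non-edge = inj₁ (zero , suc zero , (λ ()) , line-universal zero (suc zero) covered)
    where
    covered : ∀ x → lookup (line H zero (suc zero)) x ≡ true
    covered zero    = ∈-lineˡ zero (suc zero)
    covered (suc b) with zero ≟ b
    ... | yes refl = ∈-lineʳ zero (suc zero)
    ... | no  0≢b  = trans (lookup-line-off (λ ()) (0≢b ∘ sym ∘ suc-injective))
                           (¬-not λ non-edge → ∄non-edge (zero , b , 0≢b , non-edge))

  one-triangle : ApexTriangle t → HasUniversalLine H ⊎ LinesAvoidingApex 1
  one-triangle {w , v} ▵@(0≢w , w≢v , 0≢v , 0w≡0v , _) with any? (λ y → ¬? (suc y ∈ᵥ? (w , v)))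
  ... | yes (y , y∉t) =
    inj₂ ((w , suc y) ∷ (v , suc y) ∷ [] ,
          ((λ e → y∉t (inj₁ (sym e))) ∷ (λ e → y∉t (inj₂ (sym e))) ∷ [] ,
           (lines-from-side-distinct ▵ (inj₁ refl) (inj₂ refl) w≢v off ∷ []) ∷ [] ∷ []) ,
          off-line-avoids ▵ (inj₁ refl) off ∷ off-line-avoids ▵ (inj₂ refl) off ∷ [] ,
          ≤-refl)
    where
    off : Off (w , v) (suc y)
    off = (λ ()) , y∉t
  ... | no ∄off = inj₁ (zero , v , 0≢v , line-universal zero v covered)
    where
    covered : ∀ x → lookup (line H zero v) x ≡ true
    covered zero = ∈-lineˡ zero v
    covered (suc y) with suc y ∈ᵥ? (w , v)
    ... | yes (inj₁ refl) = trans (lookup-line-off (≢-sym 0≢w) w≢v)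
                                  (line≡⇒edge {c = zero} {d = suc y} (sym 0w≡0v) (≢-sym 0≢w) w≢v (∈-lineʳ zero (suc y)))
    ... | yes (inj₂ refl) = ∈-lineʳ zero v
    ... | no  y∉t         = contradiction (y , y∉t) ∄off

  lines-avoiding-apex : ∀ ts → All ApexTriangle ts → AllPairs Disjoint ts →
                        HasUniversalLine H ⊎ LinesAvoidingApex (length ts)
  lines-avoiding-apex []           _        _        = no-triangle
  lines-avoiding-apex (_ ∷ [])     (▵ ∷ []) _        = one-triangle ▵
  lines-avoiding-apex (t ∷ u ∷ ts) ▵s       disjoint =
    inj₂ (blocks (t ∷ u ∷ ts) , blocks-lines _ ▵s disjoint , blocks-avoid _ ▵s disjoint ,
          s≤s (s≤s (s≤s (blocks-length ts))))

  -- Lines through the apex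

  _≟ˢ_ : DecidableEquality (Subset (suc (suc m)))
  _≟ˢ_ = ≡-dec _≟ᵇ_

  star : Fin (suc m) → Subset (suc (suc m))
  star j = line H zero (suc j)

  -- Opaque, since unfolding rep makes Agda evaluate a search over all vertices.
  opaque
    rep : Fin (suc m) → Fin (suc m)
    rep j = preimage _≟ˢ_ star (star j)

    star-rep : ∀ j → star (rep j) ≡ star j
    star-rep = f∘preimage _≟ˢ_ star

    rep-cong : star i ≡ star j → rep i ≡ rep j
    rep-cong = cong (preimage _≟ˢ_ star)

  rep-cong⁻¹ : ∀ {i j} → rep i ≡ rep j → star i ≡ star j
  rep-cong⁻¹ {i} {j} ri≡rj = trans (sym (star-rep i)) (trans (cong star ri≡rj) (star-rep j))

  rep≢nonrep : ∀ {i j} → rep j ≢ j → rep i ≢ j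
  rep≢nonrep {i} {j} rj≢j ri≡j = rj≢j (trans (cong rep (sym ri≡j)) (trans (rep-cong (star-rep i)) ri≡j))

  star-edge : ∀ {i j} → i ≢ j → star i ≡ star j → E H zero (suc i) (suc j) ≡ true
  star-edge {i} {j} i≢j si≡sj = line≡⇒edge {c = zero} {d = suc j} si≡sj (λ ()) (i≢j ∘ sym ∘ suc-injective) (∈-lineʳ zero (suc j))

  sides : Fin (suc m) → V × V
  sides j = suc (rep j) , suc j

  sides-disjoint : ∀ {i j} → rep i ≢ i → rep j ≢ j → rep i ≢ rep j → i ≢ j → Disjoint (sides i) (sides j)
  sides-disjoint _     _     ri≢rj _   _ (inj₁ refl) (inj₁ e) = ri≢rj (suc-injective e)
  sides-disjoint _     rj≢j  _     _   _ (inj₁ refl) (inj₂ e) = rep≢nonrep rj≢j (suc-injective e)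
  sides-disjoint ri≢i  _     _     _   _ (inj₂ refl) (inj₁ e) = rep≢nonrep ri≢i (sym (suc-injective e))
  sides-disjoint _     _     _     i≢j _ (inj₂ refl) (inj₂ e) = i≢j (suc-injective e)

  Triangular : Fin (suc m) → Set
  Triangular j = rep j ≢ j × line H (suc (rep j)) (suc j) ≡ star j

  triangular? : Decidable Triangular
  triangular? j = ¬? (rep j ≟ j) ×-dec (line H (suc (rep j)) (suc j) ≟ˢ star j)

  triangular-triangle : Triangular j → ApexTriangle (sides j)
  triangular-triangle {j} (rj≢j , side≡star) = (λ ()) , rj≢j ∘ suc-injective , (λ ()) , star-rep j , side≡star

  triangular-reps-differ : ∀ {i j} → Triangular i → Triangular j → i ≢ j → rep i ≢ rep j
  triangular-reps-differ {i} {j} ▵i (rj≢j , _) i≢j ri≡rj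
    with trans (sym (star-edge i≢j (rep-cong⁻¹ ri≡rj)))
               (proj₁ (proj₂ (triangle-closed no4 (triangular-triangle ▵i) (λ ())
                                (rep≢nonrep rj≢j ∘ sym ∘ suc-injective) (i≢j ∘ sym ∘ suc-injective))))
  ... | ()

  triangular-disjoint : Triangular i → Triangular j → i ≢ j → Disjoint (sides i) (sides j)
  triangular-disjoint ▵i ▵j i≢j = sides-disjoint (proj₁ ▵i) (proj₁ ▵j) (triangular-reps-differ ▵i ▵j i≢j) i≢j

  spoke : Fin (suc m) → V × V
  spoke j with rep j ≟ j
  ... | yes _ = zero , suc j
  ... | no  _ = sides j

  spoke-proper : ∀ j → Proper (spoke j)
  spoke-proper j with rep j ≟ j
  ... | yes _    = λ ()
  ... | no  rj≢j = rj≢j ∘ suc-injective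

  spoke-through : ∀ j → Through (spoke j)
  spoke-through j with rep j ≟ j
  ... | yes _    = ∈-lineˡ zero (suc j)
  ... | no  rj≢j = trans (lookup-line-off (λ ()) (λ ()))
                         (trans (sym (E-rotate zero _ _)) (star-edge rj≢j (star-rep j)))

  class-lines-distinct : ∀ {r i j} → star r ≡ star i → star r ≡ star j → r ≢ i → r ≢ j → i ≢ j →
                         line H (suc r) (suc i) ≢ line H (suc r) (suc j)
  class-lines-distinct {r} {i} {j} sr≡si sr≡sj r≢i r≢j i≢j lines≡ =
    no4 zero (suc r) (suc i) (suc j)
      ((λ ()) , (λ ()) , (λ ()) , r≢i ∘ suc-injective , r≢j ∘ suc-injective , i≢j ∘ suc-injective ,
       star-edge r≢i sr≡si , star-edge r≢j sr≡sj , star-edge i≢j (trans (sym sr≡si) sr≡sj) ,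
       line≡⇒edge {c = suc r} {d = suc j} lines≡ (r≢j ∘ sym ∘ suc-injective) (i≢j ∘ sym ∘ suc-injective) (∈-lineʳ (suc r) (suc j)))

  star≢side : ∀ {i j} → ¬ Triangular j → i ≢ j → rep j ≢ j → star i ≢ lineOf (sides j)
  star≢side {i} {j} ¬▵j i≢j rj≢j with i ≟ rep j
  ... | yes refl = λ eq → ¬▵j (rj≢j , trans (sym eq) (star-rep j))
  ... | no  i≢rj = disjoint-lines-distinct no4 {zero , suc i} {sides j} (λ ()) (rj≢j ∘ suc-injective) λ
    { _ (inj₁ refl) (inj₁ ())
    ; _ (inj₁ refl) (inj₂ ())
    ; _ (inj₂ refl) (inj₁ e) → i≢rj (suc-injective e)
    ; _ (inj₂ refl) (inj₂ e) → i≢j (suc-injective e)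
    }

  spokes-distinct : ¬ Triangular i → ¬ Triangular j → i ≢ j → lineOf (spoke i) ≢ lineOf (spoke j)
  spokes-distinct {i} {j} ¬▵i ¬▵j i≢j with rep i ≟ i | rep j ≟ j
  ... | yes ri≡i | yes rj≡j = λ si≡sj → i≢j (trans (sym ri≡i) (trans (rep-cong si≡sj) rj≡j))
  ... | yes _    | no  rj≢j = star≢side ¬▵j i≢j rj≢j
  ... | no  ri≢i | yes _    = ≢-sym (star≢side ¬▵i (≢-sym i≢j) ri≢i)
  ... | no  ri≢i | no  rj≢j with rep i ≟ rep j
  ...   | no  ri≢rj = disjoint-lines-distinct no4 (ri≢i ∘ suc-injective) (rj≢j ∘ suc-injective)
                        (sides-disjoint ri≢i rj≢j ri≢rj i≢j)
  ...   | yes ri≡rj = λ eq →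
    class-lines-distinct (star-rep i) (trans (star-rep i) (rep-cong⁻¹ ri≡rj)) ri≢i (rep≢nonrep rj≢j) i≢j
      (trans eq (cong (λ r → line H (suc r) (suc j)) (sym ri≡rj)))

  triangular-vertices : List (Fin (suc m))
  triangular-vertices = filter triangular? (allFin (suc m))

  other-vertices : List (Fin (suc m))
  other-vertices = filter (∁? triangular?) (allFin (suc m))

  triangles : List (V × V)
  triangles = map sides triangular-vertices

  spokes : List (V × V)
  spokes = map spoke other-vertices

  triangles-apex : All ApexTriangle triangles
  triangles-apex = All.map⁺ (All.map triangular-triangle (All.all-filter triangular? (allFin (suc m))))

  triangles-disjoint : AllPairs Disjoint triangles
  triangles-disjoint = AllPairs.map⁺ (AllPairs-mapWithAll triangular-disjoint
    (All.all-filter triangular? (allFin (suc m))) (Unique.filter⁺ triangular? (Unique.allFin⁺ (suc m))))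

  spokes-lines : DistinctLines spokes
  spokes-lines =
    All.map⁺ (All.universal spoke-proper other-vertices) ,
    AllPairs.map⁺ (AllPairs-mapWithAll spokes-distinct
      (All.all-filter (∁? triangular?) (allFin (suc m))) (Unique.filter⁺ (∁? triangular?) (Unique.allFin⁺ (suc m))))

  vertex-count : length triangles + length spokes ≡ suc m
  vertex-count = begin
    length triangles + length spokes
      ≡⟨ cong₂ _+_ (length-map sides triangular-vertices) (length-map spoke other-vertices) ⟩
    length triangular-vertices + length other-vertices
      ≡⟨ length-filter+filter-∁ triangular? (allFin (suc m)) ⟩
    length (allFin (suc m))
      ≡⟨ length-tabulate (λ x → x) ⟩
    suc m ∎
    where open ≡-Reasoning

  de-bruijn–erdős : AtLeastNLines H ⊎ HasUniversalLine H
  de-bruijn–erdős with lines-avoiding-apex triangles triangles-apex triangles-disjoint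
  ... | inj₁ universal = inj₂ universal
  ... | inj₂ (ps , ps-lines , ps-avoid , ps-long) =
    inj₁ (DistinctLines⇒AtLeastNLines
           (DistinctLines-separated zero ps-avoid (All.map⁺ (All.universal spoke-through other-vertices))
              ps-lines spokes-lines)
           enough)
    where
    open ≤-Reasoning
    enough : suc (suc m) ≤ length (ps ++ spokes)
    enough = begin
      suc (suc m)                          ≡⟨ cong suc vertex-count ⟨
      suc (length triangles) + length spokes ≤⟨ +-monoˡ-≤ (length spokes) ps-long ⟩
      length ps + length spokes            ≡⟨ length-++ ps ⟨
      length (ps ++ spokes)                ∎

theorem6 : (n : ℕ) → 2 ≤ n → (H : Hypergraph3 n) → No4Induced H →
    AtLeastNLines H ⊎ HasUniversalLine H
theorem6 (suc (suc m)) _ H no4 = Apex.de-bruijn–erdős H no4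
theorem6 (suc zero) (s≤s ()) _ _
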